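{- For every integer $p\geq 1$ there exists an integer $n\geq 1$ such that the Fibonacci-sum graph $G_n$ has exactly $p$ vertices of degree $1$.
   Context: The Fibonacci numbers are defined by $F_0=0$, $F_1=1$ and $F_m=F_{m-1}+F_{m-2}$ for $m\geq 2$. For each integer $n\geq 1$, the Fibonacci-sum graph $G_n$ is the simple graph with vertex set $\{1,2,\dots,n\}$ in which distinct vertices $i,j$ are adjacent if and only if $i+j$ is a Fibonacci number. -}

module Defs where

open import Data.Nat using (ℕ; zero; suc; _+_; _≤_; _<_; z≤n; s≤s)
open import Data.Nat.Properties using (_≟_; ≤-trans; +-mono-≤; ≤-refl; n≤1+n; ≤-pred; <⇒≢; ≤-step; m≤m+n; +-comm)
open import Data.Product using (Σ; ∃; _,_; _×_; proj₁; proj₂)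
open import Data.List using (List; length; filter; upTo; map)
open import Relation.Nullary using (Dec; yes; no; ¬_)
open import Relation.Nullary.Decidable using (_×-dec_; ¬?)
open import Relation.Binary.PropositionalEquality using (_≡_; refl; sym; subst)
open import Data.Nat.Properties using (≤-<-connex)

fib : ℕ → ℕ
fib zero = 0
fib (suc zero) = 1
fib (suc (suc m)) = fib (suc m) + fib m

IsFib : ℕ → Set
IsFib m = ∃ λ k → fib k ≡ m

Adjacent : ℕ → ℕ → Set
Adjacent i j = (¬ i ≡ j) × IsFib (i + j)

-- Decidability of IsFib via bounded search (fib k ≥ k ∸ 1, so k ≤ m + 1 suffices).
private
  fib-pos : ∀ k → 1 ≤ fib (suc k)
  fib-pos zero = s≤s z≤n
  fib-pos (suc k) = ≤-trans (fib-pos k) (m≤m+n _ _)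

  fib-grow : ∀ k → k ≤ suc (fib k)
  fib-grow zero = z≤n
  fib-grow (suc zero) = s≤s z≤n
  fib-grow (suc (suc zero)) = s≤s (s≤s z≤n)
  fib-grow (suc (suc (suc k))) =
    ≤-trans (s≤s (fib-grow (suc (suc k))))
      (s≤s (subst (_≤ fib (suc (suc k)) + fib (suc k)) (+-comm (fib (suc (suc k))) 1)
              (+-mono-≤ (≤-refl {fib (suc (suc k))}) (fib-pos k))))

  search : (m b : ℕ) → Dec (∃ λ k → k < b × fib k ≡ m)
  search m zero = no λ { (k , () , _) }
  search m (suc b) with fib b ≟ m | search m b
  ... | yes e | _ = yes (b , ≤-refl , e)
  ... | no _ | yes (k , k<b , e) = yes (k , ≤-trans k<b (n≤1+n _) , e)
  ... | no ne | no nk = no λ { (k , k<sb , e) → helper k k<sb e }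
    where
    helper : ∀ k → k < suc b → fib k ≡ m → _
    helper k (s≤s k≤b) e with k ≟ b
    ... | yes refl = ne e
    ... | no k≢b = nk (k , lt k≤b k≢b , e)
      where
      lt : ∀ {k b} → k ≤ b → ¬ k ≡ b → k < b
      lt {zero} {zero} _ ne = Data.Empty.⊥-elim (ne refl) where import Data.Empty
      lt {zero} {suc b} _ _ = s≤s z≤n
      lt {suc k} {suc b} (s≤s p) ne = s≤s (lt p λ { refl → ne refl })

isFib? : (m : ℕ) → Dec (IsFib m)
isFib? m with search m (suc (suc (suc m)))
... | yes (k , _ , e) = yes (k , e)
... | no nk = no λ { (k , e) → nk (k , ≤-trans (s≤s (subst (λ x → k ≤ suc x) e (fib-grow k))) (n≤1+n _) , e) }

adjacent? : (i j : ℕ) → Dec (Adjacent i j)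
adjacent? i j = ¬? (i ≟ j) ×-dec isFib? (i + j)

vertices : ℕ → List ℕ
vertices n = map suc (upTo n)

degree : ℕ → ℕ → ℕ
degree n i = length (filter (adjacent? i) (vertices n))

numDegreeOne : ℕ → ℕ
numDegreeOne n = length (filter (λ i → degree n i ≟ 1) (vertices n))

module Submission where

-- Take K = 3t with t = p + 1, put F = F_{K+1} and n = F + (p − 1).  Then
--   * upper layer: every vertex F ≤ i ≤ n has exactly one neighbour, F_{K+2} − i,
--     because 2n < F_{K+3} forces i + j = F_{K+2} for any neighbour j;
--   * lower layer: every vertex 1 ≤ i < F has two neighbours.  If F_b ≤ i < F_{b+1}
--     they are F_{b+1} − i and F_{b+2} − i, unless 2i = F_{b+2}, when F_{b+3} − i
--     replaces the latter.  As 3 divides K, both F_{K+1} and F_{K+2} are odd, so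
--     2i = F_{b+2} forces b + 2 ≤ K and that third partner is still a vertex.
-- Hence the degree-one vertices are exactly F, …, n, and there are p of them.

open import Defs
open import Level using (0ℓ)
open import Function using (_∘_)
open import Data.Nat using (ℕ; zero; suc; _+_; _*_; _∸_; _%_; _≤_; _<_; _≥_; _≤?_; z≤n; s≤s; s≤s⁻¹)
open import Data.Nat.Properties
open import Data.Nat.DivMod using ([m+kn]%n≡m%n; m*n%n≡0)
open import Data.Nat.Solver using (module +-*-Solver)
open import Data.List using (length; filter; map; upTo; _++_; [_])
open import Data.List.Properties using (upTo-∷ʳ; map-++; length-++; filter-++; filter-accept; filter-reject)
open import Data.Product using (∃; _×_; _,_; proj₁; proj₂)
open import Data.Sum using (inj₁; inj₂)
open import Data.Empty using (⊥-elim)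
open import Relation.Nullary using (Dec; yes; no; ¬_)
open import Relation.Unary using (Pred; Decidable)
open import Relation.Binary.PropositionalEquality using (_≡_; _≢_; refl; sym; trans; cong; subst; subst₂; module ≡-Reasoning)

open +-*-Solver using (solve; _:+_; _:*_; _:=_; con)

vertices-suc : ∀ n → vertices (suc n) ≡ vertices n ++ [ suc n ]
vertices-suc n = trans (cong (map suc) (sym (upTo-∷ʳ n))) (map-++ suc (upTo n) [ n ])

-- Counting the vertices 1, …, n that satisfy a decidable predicate P.  Both the degree
-- of a vertex and the number of degree-one vertices are counts of this form.
module Counting {P : Pred ℕ 0ℓ} (P? : Decidable P) where

  count : ℕ → ℕ
  count n = length (filter P? (vertices n))

  count-suc : ∀ n → count (suc n) ≡ count n + length (filter P? [ suc n ])
  count-suc n = begin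
    length (filter P? (vertices (suc n)))                 ≡⟨ cong (length ∘ filter P?) (vertices-suc n) ⟩
    length (filter P? (vertices n ++ [ suc n ]))          ≡⟨ cong length (filter-++ P? (vertices n) [ suc n ]) ⟩
    length (filter P? (vertices n) ++ filter P? [ suc n ]) ≡⟨ length-++ (filter P? (vertices n)) ⟩
    count n + length (filter P? [ suc n ])                ∎
    where open ≡-Reasoning

  count-hit : ∀ {n} → P (suc n) → count (suc n) ≡ suc (count n)
  count-hit {n} p = trans (count-suc n) (trans (cong (λ l → count n + length l) (filter-accept P? p)) (+-comm (count n) 1))

  count-miss : ∀ {n} → ¬ P (suc n) → count (suc n) ≡ count n
  count-miss {n} ¬p = trans (count-suc n) (trans (cong (λ l → count n + length l) (filter-reject P? ¬p)) (+-identityʳ (count n)))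

  count-mono : ∀ {m n} → m ≤ n → count m ≤ count n
  count-mono {m} {n} m≤n with m≤n⇒m<n∨m≡n m≤n
  ... | inj₂ refl = ≤-refl
  ... | inj₁ (s≤s {n = n′} m≤n′) =
    ≤-trans (count-mono m≤n′) (≤-trans (m≤m+n (count n′) _) (≤-reflexive (sym (count-suc n′))))

  count-flat : ∀ {m n} → m ≤ n → (∀ j → m < j → j ≤ n → ¬ P j) → count n ≡ count m
  count-flat {m} {n} m≤n none with m≤n⇒m<n∨m≡n m≤n
  ... | inj₂ refl = refl
  ... | inj₁ (s≤s {n = n′} m≤n′) =
    trans (count-miss (none (suc n′) (s≤s m≤n′) ≤-refl))
          (count-flat m≤n′ (λ j m<j j≤n′ → none j m<j (m≤n⇒m≤1+n j≤n′)))

  count-full : ∀ {m n} → m ≤ n → (∀ j → m < j → j ≤ n → P j) → count n ≡ (n ∸ m) + count m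
  count-full {m} {n} m≤n all with m≤n⇒m<n∨m≡n m≤n
  ... | inj₂ refl = cong (_+ count m) (sym (n∸n≡0 m))
  ... | inj₁ (s≤s {n = n′} m≤n′) = begin
    count (suc n′)               ≡⟨ count-hit (all (suc n′) (s≤s m≤n′) ≤-refl) ⟩
    suc (count n′)               ≡⟨ cong suc (count-full m≤n′ (λ j m<j j≤n′ → all j m<j (m≤n⇒m≤1+n j≤n′))) ⟩
    suc ((n′ ∸ m) + count m)     ≡⟨ cong (_+ count m) (sym (+-∸-assoc 1 m≤n′)) ⟩
    (suc n′ ∸ m) + count m       ∎
    where open ≡-Reasoning

  count-segment : ∀ {n c} → 1 ≤ c → c ≤ suc n →
                  (∀ j → 1 ≤ j → j < c → ¬ P j) → (∀ j → c ≤ j → j ≤ n → P j) →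
                  count n ≡ suc n ∸ c
  count-segment {n} {suc c} _ c<n below above = begin
    count n            ≡⟨ count-full (s≤s⁻¹ c<n) above ⟩
    (n ∸ c) + count c  ≡⟨ cong ((n ∸ c) +_) (count-flat z≤n (λ j j≥1 j≤c → below j j≥1 (s≤s j≤c))) ⟩
    (n ∸ c) + 0        ≡⟨ +-identityʳ (n ∸ c) ⟩
    n ∸ c              ∎
    where open ≡-Reasoning

  count-≥2 : ∀ {n a b} → 1 ≤ a → a < b → b ≤ n → P a → P b → 2 ≤ count n
  count-≥2 {n} {suc a} {suc b} _ (s≤s a<b) b≤n pa pb = begin
    2                    ≤⟨ s≤s (s≤s z≤n) ⟩
    suc (suc (count a))  ≡⟨ cong suc (sym (count-hit pa)) ⟩
    suc (count (suc a))  ≤⟨ s≤s (count-mono a<b) ⟩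
    suc (count b)        ≡⟨ sym (count-hit pb) ⟩
    count (suc b)        ≤⟨ count-mono b≤n ⟩
    count n              ∎
    where open ≤-Reasoning

  count-one : ∀ {n c} → 1 ≤ c → c ≤ n → P c → (∀ j → 1 ≤ j → j ≤ n → P j → j ≡ c) → count n ≡ 1
  count-one {n} {suc c} _ c≤n pc unique = begin
    count n        ≡⟨ count-flat c≤n (λ j c<j j≤n pj → <-irrefl (sym (unique j (≤-trans (s≤s z≤n) c<j) j≤n pj)) c<j) ⟩
    count (suc c)  ≡⟨ count-hit pc ⟩
    suc (count c)  ≡⟨ cong suc (count-flat z≤n (λ j j≥1 j≤c pj → <-irrefl (unique j j≥1 (≤-trans (m≤n⇒m≤1+n j≤c) c≤n) pj) (s≤s j≤c))) ⟩
    1              ∎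
    where open ≡-Reasoning

open Counting using (count-segment; count-≥2; count-one)

fib-step : ∀ n → fib n ≤ fib (suc n)
fib-step zero    = z≤n
fib-step (suc n) = m≤m+n (fib (suc n)) (fib n)

fib-mono : ∀ {m n} → m ≤ n → fib m ≤ fib n
fib-mono m≤n with m≤n⇒m<n∨m≡n m≤n
... | inj₂ refl = ≤-refl
... | inj₁ (s≤s {n = n′} m≤n′) = ≤-trans (fib-mono m≤n′) (fib-step n′)

fib-pos : ∀ n → 1 ≤ fib (suc n)
fib-pos zero    = ≤-refl
fib-pos (suc n) = ≤-trans (fib-pos n) (m≤m+n (fib (suc n)) (fib n))

fib-strict : ∀ n → 2 ≤ n → fib n < fib (suc n)
fib-strict (suc zero)    (s≤s ())
fib-strict (suc (suc n)) _ = m<m+n (fib (suc (suc n))) (fib-pos n)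

fib-reflects-< : ∀ {a c} → fib a < fib c → a < c
fib-reflects-< lt = ≰⇒> (λ c≤a → <⇒≱ lt (fib-mono c≤a))

fib-gap : ∀ {a c} → fib a < fib c → fib c < fib (2 + a) → c ≡ suc a
fib-gap {a} {c} lo hi = ≤-antisym (s≤s⁻¹ (fib-reflects-< {c} {2 + a} hi)) (fib-reflects-< {a} {c} lo)

fib-grow : ∀ k → k ≤ suc (fib k)
fib-grow zero                = z≤n
fib-grow (suc zero)          = s≤s z≤n
fib-grow (suc (suc zero))    = s≤s (s≤s z≤n)
fib-grow (suc (suc (suc k))) = s≤s (≤-trans (fib-grow (suc (suc k))) (fib-strict (suc (suc k)) (s≤s (s≤s z≤n))))

fib-bracket : ∀ {i} → 2 ≤ i → ∃ λ b → 3 ≤ b × fib b ≤ i × i < fib (suc b)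
fib-bracket {i} i≥2 = search (2 + i) (s≤s⁻¹ (fib-grow (2 + i)))
  where
  search : ∀ c → i < fib c → ∃ λ b → 3 ≤ b × fib b ≤ i × i < fib (suc b)
  search zero ()
  search (suc c) i<F with fib c ≤? i
  ... | no F≰i = search c (≰⇒> F≰i)
  ... | yes F≤i with 3 ≤? c
  ...   | yes c≥3 = c , c≥3 , F≤i , i<F
  ...   | no c≱3  = ⊥-elim (<⇒≱ i<F (≤-trans (fib-mono {suc c} {3} (≰⇒> c≱3)) i≥2))

fib-suc<double : ∀ {b} → 3 ≤ b → fib (suc b) < fib b + fib b
fib-suc<double {suc b} (s≤s b≥2) = +-monoʳ-< (fib (suc b)) (fib-strict b b≥2)

-- Parity: F_{3t+1} and F_{3t+2} are odd, because F_{a+3} = F_a + 2 F_{a+1}.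

fib-mod2-period : ∀ a → fib (3 + a) % 2 ≡ fib a % 2
fib-mod2-period a = trans (cong (_% 2) triple) ([m+kn]%n≡m%n (fib a) (fib (suc a)) 2)
  where
  triple : fib (3 + a) ≡ fib a + fib (suc a) * 2
  triple = solve 2 (λ x y → (y :+ x) :+ y := x :+ y :* con 2) refl (fib a) (fib (suc a))

fib-odd : ∀ t → fib (1 + t * 3) % 2 ≡ 1 × fib (2 + t * 3) % 2 ≡ 1
fib-odd zero    = refl , refl
fib-odd (suc t) = trans (fib-mod2-period (1 + t * 3)) (proj₁ (fib-odd t))
                , trans (fib-mod2-period (2 + t * 3)) (proj₂ (fib-odd t))

double-not-odd : ∀ {x} i → x % 2 ≡ 1 → i + i ≢ x
double-not-odd i odd ii≡x = 0≢1+n (trans (sym (m*n%n≡0 i 2)) (trans (cong (_% 2) (trans twice ii≡x)) odd))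
  where
  twice : i * 2 ≡ i + i
  twice = solve 1 (λ x → x :* con 2 := x :+ x) refl i

partner : ℕ → ℕ → ℕ
partner a i = fib a ∸ i

partner-sum : ∀ a {i} → i ≤ fib a → i + partner a i ≡ fib a
partner-sum a = m+[n∸m]≡n

partner-adjacent : ∀ a {i} → i < fib a → i + i ≢ fib a → Adjacent i (partner a i)
partner-adjacent a {i} i<F ii≢F =
  (λ i≡p → ii≢F (trans (cong (i +_) i≡p) (partner-sum a (<⇒≤ i<F)))) , a , sym (partner-sum a (<⇒≤ i<F))

two-partners : ∀ {n i} a a′ → i < fib a → fib a < fib a′ → partner a′ i ≤ n →
               i + i ≢ fib a → i + i ≢ fib a′ → 2 ≤ degree n i
two-partners {n} {i} a a′ i<F F<F′ p′≤n ii≢F ii≢F′ =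
  count-≥2 (adjacent? i) (m<n⇒0<n∸m i<F) p<p′ p′≤n (partner-adjacent a i<F ii≢F) (partner-adjacent a′ i<F′ ii≢F′)
  where
  i<F′ : i < fib a′
  i<F′ = <-trans i<F F<F′
  p<p′ : partner a i < partner a′ i
  p<p′ = +-cancelˡ-< i _ _ (subst₂ _<_ (sym (partner-sum a (<⇒≤ i<F))) (sym (partner-sum a′ (<⇒≤ i<F′))) F<F′)

bracketed-degree : ∀ {n i b} → 3 ≤ b → fib b ≤ i → i < fib (suc b) → fib (suc b) ≤ n →
                   (i + i ≡ fib (2 + b) → fib (3 + b) ≤ n) → 2 ≤ degree n i
bracketed-degree {n} {i} {b} b≥3 F≤i i<F₁ F₁≤n room = by-cases (i + i ≟ fib (2 + b))
  where
  b≥2 : 2 ≤ b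
  b≥2 = ≤-trans (n≤1+n 2) b≥3
  F₁<F₂ : fib (suc b) < fib (2 + b)
  F₁<F₂ = fib-strict (suc b) (m≤n⇒m≤1+n b≥2)
  F₂<F₃ : fib (2 + b) < fib (3 + b)
  F₂<F₃ = fib-strict (2 + b) (m≤n⇒m≤1+n (m≤n⇒m≤1+n b≥2))
  ii≢F₁ : i + i ≢ fib (suc b)
  ii≢F₁ eq = <⇒≢ (<-≤-trans (fib-suc<double b≥3) (+-mono-≤ F≤i F≤i)) (sym eq)
  p₂≤n : partner (2 + b) i ≤ n
  p₂≤n = begin
    partner (2 + b) i                ≤⟨ ∸-monoʳ-≤ (fib (2 + b)) F≤i ⟩
    (fib (suc b) + fib b) ∸ fib b    ≡⟨ m+n∸n≡m (fib (suc b)) (fib b) ⟩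
    fib (suc b)                      ≤⟨ F₁≤n ⟩
    n                                ∎
    where open ≤-Reasoning
  by-cases : Dec (i + i ≡ fib (2 + b)) → 2 ≤ degree n i
  by-cases (no ii≢F₂)  = two-partners (suc b) (2 + b) i<F₁ F₁<F₂ p₂≤n ii≢F₁ ii≢F₂
  by-cases (yes ii≡F₂) = two-partners (suc b) (3 + b) i<F₁ (<-trans F₁<F₂ F₂<F₃)
                           (≤-trans (m∸n≤m (fib (3 + b)) i) (room ii≡F₂)) ii≢F₁
                           (λ ii≡F₃ → <⇒≢ F₂<F₃ (trans (sym ii≡F₂) ii≡F₃))

double-index-room : ∀ {K b} i → b ≤ K → fib (suc K) % 2 ≡ 1 → fib (2 + K) % 2 ≡ 1 →
                    i + i ≡ fib (2 + b) → 2 + b ≤ K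
double-index-room {K} {b} i b≤K odd₁ odd₂ ii≡F = ≤∧≢⇒< (≤∧≢⇒< b≤K b≢K) sb≢K
  where
  b≢K : b ≢ K
  b≢K b≡K = double-not-odd i (subst (λ x → fib (2 + x) % 2 ≡ 1) (sym b≡K) odd₂) ii≡F
  sb≢K : suc b ≢ K
  sb≢K sb≡K = double-not-odd i (subst (λ x → fib (suc x) % 2 ≡ 1) (sym sb≡K) odd₁) ii≡F

lower-degree : ∀ {K n i} → 4 ≤ K → fib (suc K) % 2 ≡ 1 → fib (2 + K) % 2 ≡ 1 →
               1 ≤ i → i < fib (suc K) → fib (suc K) ≤ n → 2 ≤ degree n i
-- Vertex 1 lies in no bracket with b ≥ 3; its neighbours 2 = F_4 − 1 and 4 = F_5 − 1 serve.
lower-degree {i = suc zero} K≥4 _ _ _ _ F≤n =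
  two-partners 4 5 (s≤s (s≤s z≤n)) (s≤s (s≤s (s≤s (s≤s z≤n))))
    (≤-trans (n≤1+n 4) (≤-trans (fib-mono (s≤s K≥4)) F≤n)) (λ ()) (λ ())
lower-degree {K} {i = i@(suc (suc _))} K≥4 odd₁ odd₂ _ i<F F≤n with fib-bracket {i} (s≤s (s≤s z≤n))
... | b , b≥3 , Fb≤i , i<Fb′ =
  bracketed-degree b≥3 Fb≤i i<Fb′ (≤-trans (fib-mono b<K′) F≤n)
    (λ ii≡ → ≤-trans (fib-mono (s≤s (double-index-room i (s≤s⁻¹ b<K′) odd₁ odd₂ ii≡))) F≤n)
  where
  b<K′ : b < suc K
  b<K′ = fib-reflects-< {b} {suc K} (≤-<-trans Fb≤i i<F)

double-cancel-< : ∀ {a b} → a + a < b + b → a < b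
double-cancel-< lt = ≰⇒> (λ b≤a → <⇒≱ lt (+-mono-≤ b≤a b≤a))

upper-degree : ∀ {K n i} → 2 ≤ K → fib (suc K) ≤ i → i ≤ n → n + n < fib (3 + K) → degree n i ≡ 1
upper-degree {K} {n} {i} K≥2 F₁≤i i≤n nn<F₃ =
  count-one (adjacent? i) (m<n⇒0<n∸m i<F₂) c≤n (partner-adjacent (2 + K) i<F₂ ii≢F₂) unique
  where
  i<F₂ : i < fib (2 + K)
  i<F₂ = ≤-<-trans i≤n (double-cancel-< (<-≤-trans nn<F₃ (+-monoʳ-≤ (fib (2 + K)) (fib-step (suc K)))))
  c≤n : partner (2 + K) i ≤ n
  c≤n = begin
    partner (2 + K) i                       ≤⟨ ∸-monoʳ-≤ (fib (2 + K)) F₁≤i ⟩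
    (fib (suc K) + fib K) ∸ fib (suc K)     ≡⟨ m+n∸m≡n (fib (suc K)) (fib K) ⟩
    fib K                                   ≤⟨ fib-step K ⟩
    fib (suc K)                             ≤⟨ F₁≤i ⟩
    i                                       ≤⟨ i≤n ⟩
    n                                       ∎
    where open ≤-Reasoning
  ii≢F₂ : i + i ≢ fib (2 + K)
  ii≢F₂ eq = <⇒≢ (<-≤-trans (+-monoʳ-< (fib (suc K)) (fib-strict K K≥2)) (+-mono-≤ F₁≤i F₁≤i)) (sym eq)
  unique : ∀ j → 1 ≤ j → j ≤ n → Adjacent i j → j ≡ partner (2 + K) i
  unique j j≥1 j≤n (_ , l , Fl≡ij) = +-cancelˡ-≡ i j _ (trans ij≡F₂ (sym (partner-sum (2 + K) (<⇒≤ i<F₂))))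
    where
    lo : fib (suc K) < fib l
    lo = subst (fib (suc K) <_) (sym Fl≡ij) (≤-<-trans F₁≤i (m<m+n i j≥1))
    hi : fib l < fib (3 + K)
    hi = subst (_< fib (3 + K)) (sym Fl≡ij) (≤-<-trans (+-mono-≤ i≤n j≤n) nn<F₃)
    ij≡F₂ : i + j ≡ fib (2 + K)
    ij≡F₂ = trans (sym Fl≡ij) (cong fib (fib-gap {suc K} {l} lo hi))

upper-room : ∀ K m → m + m < fib K → (fib (suc K) + m) + (fib (suc K) + m) < fib (3 + K)
upper-room K m mm<F = subst₂ _<_ shuffle₁ shuffle₂ (+-monoʳ-< (fib (suc K) + fib (suc K)) mm<F)
  where
  shuffle₁ : (fib (suc K) + fib (suc K)) + (m + m) ≡ (fib (suc K) + m) + (fib (suc K) + m)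
  shuffle₁ = solve 2 (λ x y → (x :+ x) :+ (y :+ y) := (x :+ y) :+ (x :+ y)) refl (fib (suc K)) m
  shuffle₂ : (fib (suc K) + fib (suc K)) + fib K ≡ fib (3 + K)
  shuffle₂ = solve 2 (λ x y → (x :+ x) :+ y := (x :+ y) :+ x) refl (fib (suc K)) (fib K)

fib-index-large : ∀ m → m + m < fib ((2 + m) * 3)
fib-index-large m = ≤-trans (s≤s (≤-trans mm≤3m (m≤n+m (m * 3) 4))) (s≤s⁻¹ (fib-grow ((2 + m) * 3)))
  where
  mm≤3m : m + m ≤ m * 3
  mm≤3m = subst (m + m ≤_) (solve 1 (λ x → (x :+ x) :+ x := x :* con 3) refl m) (m≤m+n (m + m) m)

corollary4 : ∀ (p : ℕ) → p ≥ 1 → ∃ λ (n : ℕ) → n ≥ 1 × numDegreeOne n ≡ p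
corollary4 (suc m) _ = n , ≤-trans (fib-pos K) (m≤m+n F m) , count≡
  where
  K = (2 + m) * 3
  F = fib (suc K)
  n = F + m
  below : ∀ j → 1 ≤ j → j < F → degree n j ≢ 1
  below j j≥1 j<F d≡1 = <⇒≢ (lower-degree {K} {n} (s≤s (s≤s (s≤s (s≤s z≤n)))) (proj₁ (fib-odd (2 + m)))
                               (proj₂ (fib-odd (2 + m))) j≥1 j<F (m≤m+n F m)) (sym d≡1)
  above : ∀ j → F ≤ j → j ≤ n → degree n j ≡ 1
  above j F≤j j≤n = upper-degree {K} (s≤s (s≤s z≤n)) F≤j j≤n (upper-room K m (fib-index-large m))
  count≡ : numDegreeOne n ≡ suc m
  count≡ = begin
    numDegreeOne n   ≡⟨ count-segment (λ j → degree n j ≟ 1) (fib-pos K) (m≤n⇒m≤1+n (m≤m+n F m)) below above ⟩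
    suc (F + m) ∸ F  ≡⟨ cong (_∸ F) (sym (+-suc F m)) ⟩
    F + suc m ∸ F    ≡⟨ m+n∸m≡n F (suc m) ⟩
    suc m            ∎
    where open ≡-Reasoning
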